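{- If $s$ is an odd integer with $s\geq 3$, then $O(2s)=E(2s)$.
   Context: $\phi$ denotes Euler's totient function: for a positive integer $n$, $\phi(n)$ is the number of integers $x$ with $1\le x\le n$ and $\gcd(x,n)=1$. For a positive integer $m$, $O(m)$ (resp. $E(m)$) denotes the number of odd (resp. even) positive integers $n$ with $\phi(n)=m$. -}

module Defs where

open import Data.Nat using (ℕ; zero; suc; _%_; _≡ᵇ_; _*_)
open import Data.Nat.GCD using (gcd)
open import Data.Nat.Properties using (_≟_)
open import Data.List using (List; length; filter)
open import Data.List using (upTo)
open import Data.Product using (Σ; _×_)
open import Relation.Binary.PropositionalEquality using (_≡_)

oneTo : ℕ → List ℕ
oneTo n = Data.List.map suc (upTo n)

φ : ℕ → ℕ
φ n = length (filter (λ x → gcd x n ≟ 1) (oneTo n))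

Odd : ℕ → Set
Odd n = n % 2 ≡ 1

Even : ℕ → Set
Even n = n % 2 ≡ 0

OddPre : ℕ → Set
OddPre m = Σ ℕ (λ n → (0 Data.Nat.< n) × Odd n × φ n ≡ m)

EvenPre : ℕ → Set
EvenPre m = Σ ℕ (λ n → (0 Data.Nat.< n) × Even n × φ n ≡ m)

module Submission where

open import Defs
open import Data.Nat using (ℕ; _≤_; _*_)
open import Function.Bundles using (_↔_)

open import Data.Nat using (zero; suc; _+_; _∸_; _<_; _%_; s≤s; z≤n; ⌊_/2⌋)
open import Data.Nat.Properties
open import Data.Nat.DivMod using (%-distribˡ-+; m*n%n≡0)
open import Data.Nat.Divisibility
  using (_∣_; divides; ∣-refl; ∣-trans; ∣m+n∣m⇒∣n; ∣m∣n⇒∣m+n; ∣⇒≤; n∣m⇒m%n≡0; m%n≡0⇒n∣m; 0∣⇒≡0)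
open import Data.Nat.GCD using (gcd)
open import Data.Nat.Coprimality
  using (Coprime; gcd≡1⇒coprime; coprime⇒gcd≡1; coprime-divisor; coprime-+; coprime?)
open import Data.List using (length; filter; map; applyUpTo)
open import Data.Product using (Σ; _×_; _,_)
open import Data.Sum using (_⊎_; inj₁; inj₂)
open import Data.Empty using (⊥-elim)
open import Relation.Nullary using (Dec; yes; no; ¬_)
open import Relation.Binary.PropositionalEquality
  using (_≡_; _≢_; refl; sym; trans; cong; cong₂; subst; module ≡-Reasoning)
open import Function.Bundles using (mk↔ₛ′)
open import Algebra.Properties.CommutativeSemigroup +-commutativeSemigroup using (interchange)

-- Write φ(n) as a finite sum of coprimality indicators and
-- derive three classical facts by manipulating these sums:
--   (A) φ(2n) = 2 φ(n) for n even   (x ↦ x + n permutes residues mod n),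
--   (B) φ(2n) = φ(n)   for n odd    (of x and x + n exactly one is odd),
--   (C) φ(n) is even for n ≥ 3      (x ↦ n - x pairs up the coprime residues;
--                                    even n reduce to odd ones by (A), (B)).
-- Given odd s ≥ 3, (C) shows that no m has φ(m) = s.  Hence every n with
-- φ(n) = 2s and n = 2m even has m odd: otherwise (A) would give φ(m) = s.
-- So n ↦ 2n is a bijection from odd to even solutions of φ(n) = 2s, with
-- inverse n ↦ ⌊n/2⌋, by (B).

data Parity : ℕ → Set where
  even : ∀ k → Parity (2 * k)
  odd  : ∀ k → Parity (suc (2 * k))

parity : ∀ n → Parity n
parity zero = even 0
parity (suc n) with parity n
... | even k = odd k
... | odd k = subst Parity (cong suc (+-suc k (k + 0))) (even (suc k))

double≡+ : ∀ n → 2 * n ≡ n + n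
double≡+ n = cong (n +_) (+-identityʳ n)

even-double : ∀ n → Even (2 * n)
even-double n = subst Even (*-comm n 2) (m*n%n≡0 n 2)

even⇒¬odd : ∀ n → Even n → ¬ Odd n
even⇒¬odd n e o with trans (sym e) o
... | ()

odd+odd : ∀ m n → Odd m → Odd n → Even (m + n)
odd+odd m n om on = trans (%-distribˡ-+ m n 2) (cong₂ (λ a b → (a + b) % 2) om on)

odd+even : ∀ m n → Odd m → Even n → Odd (m + n)
odd+even m n om en = trans (%-distribˡ-+ m n 2) (cong₂ (λ a b → (a + b) % 2) om en)

odd-double+1 : ∀ n → Odd (suc (2 * n))
odd-double+1 n = odd+even 1 (2 * n) refl (even-double n)

even-or-odd : ∀ n → Even n ⊎ Odd n
even-or-odd n with parity n
... | even k = inj₁ (even-double k)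
... | odd k = inj₂ (odd-double+1 k)

even⇒2∣ : ∀ {n} → Even n → 2 ∣ n
even⇒2∣ {n} = m%n≡0⇒n∣m n 2

odd⇒2∤ : ∀ {n} → Odd n → ¬ 2 ∣ n
odd⇒2∤ {n} o d = even⇒¬odd n (n∣m⇒m%n≡0 n 2 d) o

halve-even : ∀ n → Even n → 2 * ⌊ n /2⌋ ≡ n
halve-even n e = trans (double≡+ ⌊ n /2⌋) (go n e)
  where
  go : ∀ n → Even n → ⌊ n /2⌋ + ⌊ n /2⌋ ≡ n
  go 0 _ = refl
  go (suc (suc n)) e = cong suc (trans (+-suc ⌊ n /2⌋ ⌊ n /2⌋) (cong suc (go n e)))

halve-double : ∀ n → ⌊ 2 * n /2⌋ ≡ n
halve-double n = trans (cong ⌊_/2⌋ (double≡+ n)) (sym (n≡⌊n+n/2⌋ n))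

sumBelow : ℕ → (ℕ → ℕ) → ℕ
sumBelow zero h = 0
sumBelow (suc n) h = h 0 + sumBelow n (λ i → h (suc i))

syntax sumBelow n (λ i → e) = ∑[ i < n ] e

sum-cong : ∀ n {h k : ℕ → ℕ} → (∀ i → i < n → h i ≡ k i) → ∑[ i < n ] h i ≡ ∑[ i < n ] k i
sum-cong zero e = refl
sum-cong (suc n) e = cong₂ _+_ (e 0 (s≤s z≤n)) (sum-cong n (λ i lt → e (suc i) (s≤s lt)))

sum-split : ∀ a b (h : ℕ → ℕ) → ∑[ i < a + b ] h i ≡ ∑[ i < a ] h i + ∑[ i < b ] h (a + i)
sum-split zero b h = refl
sum-split (suc a) b h =
  trans (cong (h 0 +_) (sum-split a b (λ i → h (suc i)))) (sym (+-assoc (h 0) _ _))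

sum-+ : ∀ n (h k : ℕ → ℕ) → ∑[ i < n ] h i + ∑[ i < n ] k i ≡ ∑[ i < n ] (h i + k i)
sum-+ zero h k = refl
sum-+ (suc n) h k = trans (interchange (h 0) _ (k 0) _)
  (cong ((h 0 + k 0) +_) (sum-+ n (λ i → h (suc i)) (λ i → k (suc i))))

sum-last : ∀ n h → ∑[ i < suc n ] h i ≡ ∑[ i < n ] h i + h n
sum-last zero h = +-identityʳ (h 0)
sum-last (suc n) h =
  trans (cong (h 0 +_) (sum-last n (λ i → h (suc i)))) (sym (+-assoc (h 0) _ _))

sum-reverse : ∀ n h → ∑[ i < n ] h i ≡ ∑[ i < n ] h (n ∸ suc i)
sum-reverse zero h = refl
sum-reverse (suc n) h = begin
  h 0 + ∑[ i < n ] h (suc i)           ≡⟨ cong (h 0 +_) (sum-reverse n (λ i → h (suc i))) ⟩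
  h 0 + ∑[ i < n ] h (suc (n ∸ suc i)) ≡⟨ cong (h 0 +_) (sum-cong n (λ i lt → cong h (sym (+-∸-assoc 1 lt)))) ⟩
  h 0 + ∑[ i < n ] h (n ∸ i)           ≡⟨ +-comm (h 0) _ ⟩
  ∑[ i < n ] h (n ∸ i) + h 0           ≡⟨ cong (λ t → ∑[ i < n ] h (n ∸ i) + h t) (sym (n∸n≡0 n)) ⟩
  ∑[ i < n ] h (n ∸ i) + h (n ∸ n)     ≡⟨ sym (sum-last n (λ i → h (n ∸ i))) ⟩
  ∑[ i < suc n ] h (n ∸ i)             ∎
  where open ≡-Reasoning

coprime-shift : ∀ {x n} → Coprime (n + x) n → Coprime x n
coprime-shift c (d∣x , d∣n) = c (∣m∣n⇒∣m+n d∣n d∣x , d∣n)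

coprime-reflect : ∀ {x n} → x ≤ n → Coprime x n → Coprime (n ∸ x) n
coprime-reflect {x} {n} x≤n c {d} (d∣n∸x , d∣n) =
  c (∣m+n∣m⇒∣n (subst (d ∣_) (sym (m∸n+n≡m x≤n)) d∣n) d∣n∸x , d∣n)

coprime-reflect⁻ : ∀ {x n} → x ≤ n → Coprime (n ∸ x) n → Coprime x n
coprime-reflect⁻ {x} {n} x≤n c =
  subst (λ y → Coprime y n) (m∸[m∸n]≡n x≤n) (coprime-reflect (m∸n≤m n x) c)

coprime-double⇒coprime : ∀ {x n} → Coprime x (2 * n) → Coprime x n
coprime-double⇒coprime c (d∣x , d∣n) = c (d∣x , ∣-trans d∣n (divides 2 refl))

coprime-double⇒odd : ∀ {x n} → Coprime x (2 * n) → Odd x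
coprime-double⇒odd {x} {n} c with even-or-odd x
... | inj₂ o = o
... | inj₁ e with c (even⇒2∣ e , divides n (*-comm 2 n))
... | ()

odd-coprime⇒coprime-double : ∀ {x n} → Odd x → Coprime x n → Coprime x (2 * n)
odd-coprime⇒coprime-double {x} {n} o c {d} (d∣x , d∣2n) = c (d∣x , coprime-divisor d⊥2 d∣2n)
  where
  d⊥2 : Coprime d 2
  d⊥2 {zero} (_ , 0∣2) with 0∣⇒≡0 0∣2
  ... | ()
  d⊥2 {1} _ = refl
  d⊥2 {2} (2∣d , _) = ⊥-elim (odd⇒2∤ o (∣-trans 2∣d d∣x))
  d⊥2 {suc (suc (suc _))} (_ , e∣2) with ∣⇒≤ e∣2
  ... | s≤s (s≤s ())

[_] : ∀ {P : Set} → Dec P → ℕ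
[ yes _ ] = 1
[ no _ ] = 0

χ : ℕ → ℕ → ℕ
χ n x = [ gcd x n ≟ 1 ]

χ-yes : ∀ {x n} → Coprime x n → χ n x ≡ 1
χ-yes {x} {n} c with gcd x n ≟ 1
... | yes _ = refl
... | no g≢1 = ⊥-elim (g≢1 (coprime⇒gcd≡1 c))

χ-no : ∀ n x → ¬ Coprime x n → χ n x ≡ 0
χ-no n x ¬c with gcd x n ≟ 1
... | yes g≡1 = ⊥-elim (¬c (gcd≡1⇒coprime g≡1))
... | no _ = refl

χ-cong : ∀ {x n y m} → (Coprime x n → Coprime y m) → (Coprime y m → Coprime x n) → χ n x ≡ χ m y
χ-cong {x} {n} {y} {m} to from with coprime? x n
... | yes c = trans (χ-yes c) (sym (χ-yes (to c)))
... | no ¬c = trans (χ-no n x ¬c) (sym (χ-no m y (λ c → ¬c (from c))))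

length-filter : ∀ {P : ℕ → Set} (P? : ∀ x → Dec (P x)) n (g : ℕ → ℕ) →
  length (filter P? (map suc (applyUpTo g n))) ≡ ∑[ i < n ] [ P? (suc (g i)) ]
length-filter P? zero g = refl
length-filter P? (suc n) g with P? (suc (g 0))
... | yes _ = cong suc (length-filter P? n (λ i → g (suc i)))
... | no _ = length-filter P? n (λ i → g (suc i))

φ-sum : ∀ n → φ n ≡ ∑[ i < n ] χ n (suc i)
φ-sum n = length-filter (λ x → gcd x n ≟ 1) n (λ i → i)

χ-shift : ∀ n x → χ n (n + x) ≡ χ n x
χ-shift n x = χ-cong {n + x} {n} {x} {n} coprime-shift coprime-+

χ-reflect : ∀ {n x} → x ≤ n → χ n (n ∸ x) ≡ χ n x
χ-reflect x≤n = χ-cong (coprime-reflect⁻ x≤n) (coprime-reflect x≤n)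

-- For even n the odd-coprime condition is automatic, so χ (2n) = χ n.
χ-double-even : ∀ n → Even n → ∀ x → χ (2 * n) x ≡ χ n x
χ-double-even n en x = χ-cong coprime-double⇒coprime coprime⇒coprime-double
  where
  coprime⇒coprime-double : Coprime x n → Coprime x (2 * n)
  coprime⇒coprime-double c with even-or-odd x
  ... | inj₂ ox = odd-coprime⇒coprime-double ox c
  ... | inj₁ ex with c (even⇒2∣ ex , even⇒2∣ en)
  ... | ()

-- For odd n, exactly one of x and n + x is odd, so of the two residues of 2n
-- lying over x mod n precisely one is coprime to 2n when x is coprime to n.
χ-double-odd : ∀ n → Odd n → ∀ x → χ (2 * n) x + χ (2 * n) (n + x) ≡ χ n x
χ-double-odd n on x with coprime? x n
... | no ¬c = begin
  χ (2 * n) x + χ (2 * n) (n + x)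
    ≡⟨ cong₂ _+_ (χ-no (2 * n) x (λ c → ¬c (coprime-double⇒coprime c)))
                 (χ-no (2 * n) (n + x) (λ c → ¬c (coprime-shift (coprime-double⇒coprime c)))) ⟩
  0 ≡⟨ sym (χ-no n x ¬c) ⟩
  χ n x ∎
  where open ≡-Reasoning
... | yes c with even-or-odd x
...   | inj₂ ox = begin
  χ (2 * n) x + χ (2 * n) (n + x)
    ≡⟨ cong₂ _+_ (χ-yes (odd-coprime⇒coprime-double ox c))
                 (χ-no (2 * n) (n + x) (λ c′ → even⇒¬odd (n + x) (odd+odd n x on ox) (coprime-double⇒odd {n = n} c′))) ⟩
  1 ≡⟨ sym (χ-yes c) ⟩
  χ n x ∎
  where open ≡-Reasoning
...   | inj₁ ex = begin
  χ (2 * n) x + χ (2 * n) (n + x)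
    ≡⟨ cong₂ _+_ (χ-no (2 * n) x (λ c′ → even⇒¬odd x ex (coprime-double⇒odd {n = n} c′)))
                 (χ-yes (odd-coprime⇒coprime-double (odd+even n x on ex) (coprime-+ c))) ⟩
  1 ≡⟨ sym (χ-yes c) ⟩
  χ n x ∎
  where open ≡-Reasoning

φ-double-split : ∀ n → φ (2 * n) ≡ ∑[ i < n ] χ (2 * n) (suc i) + ∑[ i < n ] χ (2 * n) (n + suc i)
φ-double-split n = begin
  φ (2 * n)                                     ≡⟨ φ-sum (2 * n) ⟩
  ∑[ i < n + (n + 0) ] χ (2 * n) (suc i)         ≡⟨ sum-split n (n + 0) (λ i → χ (2 * n) (suc i)) ⟩
  L + ∑[ i < n + 0 ] χ (2 * n) (suc (n + i))     ≡⟨ cong (λ m → L + ∑[ i < m ] χ (2 * n) (suc (n + i))) (+-identityʳ n) ⟩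
  L + ∑[ i < n ] χ (2 * n) (suc (n + i))         ≡⟨ cong (L +_) (sum-cong n (λ i _ → cong (χ (2 * n)) (sym (+-suc n i)))) ⟩
  L + ∑[ i < n ] χ (2 * n) (n + suc i)           ∎
  where
  open ≡-Reasoning
  L : ℕ
  L = ∑[ i < n ] χ (2 * n) (suc i)

φ-double-even : ∀ n → Even n → φ (2 * n) ≡ 2 * φ n
φ-double-even n en = begin
  φ (2 * n)                                                     ≡⟨ φ-double-split n ⟩
  ∑[ i < n ] χ (2 * n) (suc i) + ∑[ i < n ] χ (2 * n) (n + suc i)
    ≡⟨ cong₂ _+_ (sum-cong n (λ i _ → χ-double-even n en (suc i)))
                 (sum-cong n (λ i _ → trans (χ-double-even n en (n + suc i)) (χ-shift n (suc i)))) ⟩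
  ∑[ i < n ] χ n (suc i) + ∑[ i < n ] χ n (suc i)               ≡⟨ cong (λ t → t + t) (sym (φ-sum n)) ⟩
  φ n + φ n                                                     ≡⟨ sym (double≡+ (φ n)) ⟩
  2 * φ n                                                       ∎
  where open ≡-Reasoning

φ-double-odd : ∀ n → Odd n → φ (2 * n) ≡ φ n
φ-double-odd n on = begin
  φ (2 * n)                                                     ≡⟨ φ-double-split n ⟩
  ∑[ i < n ] χ (2 * n) (suc i) + ∑[ i < n ] χ (2 * n) (n + suc i) ≡⟨ sum-+ n _ _ ⟩
  ∑[ i < n ] (χ (2 * n) (suc i) + χ (2 * n) (n + suc i))        ≡⟨ sum-cong n (λ i _ → χ-double-odd n on (suc i)) ⟩
  ∑[ i < n ] χ n (suc i)                                        ≡⟨ sym (φ-sum n) ⟩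
  φ n                                                           ∎
  where open ≡-Reasoning

¬coprime-self : ∀ {n} → 1 < n → ¬ Coprime n n
¬coprime-self 1<n c = <-irrefl (sym (c (∣-refl , ∣-refl))) 1<n

-- The index arithmetic behind the reflection x ↦ (2j + 1) - x.
mirror-index : ∀ {i j} → i < j → suc (j + (j ∸ suc i)) ≡ suc (2 * j) ∸ suc i
mirror-index {i} {j} i<j = begin
  suc (j + (j ∸ suc i)) ≡⟨ sym (+-suc j (j ∸ suc i)) ⟩
  j + suc (j ∸ suc i)   ≡⟨ cong (j +_) (sym (+-∸-assoc 1 i<j)) ⟩
  j + (j ∸ i)           ≡⟨ sym (+-∸-assoc j (<⇒≤ i<j)) ⟩
  (j + j) ∸ i           ≡⟨ cong (_∸ i) (sym (double≡+ j)) ⟩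
  2 * j ∸ i             ∎
  where open ≡-Reasoning

-- For m = 2j + 1 ≥ 3 the reflection x ↦ m - x maps the coprime residues in
-- [1, j] bijectively onto those in [j + 1, 2j], and m itself is not coprime
-- to m; hence φ(m) is twice the count over [1, j].
φ-odd-halves : ∀ j → 1 ≤ j → φ (suc (2 * j)) ≡ 2 * ∑[ i < j ] χ (suc (2 * j)) (suc i)
φ-odd-halves j 1≤j = begin
  φ m                                  ≡⟨ φ-sum m ⟩
  ∑[ i < suc (2 * j) ] h i             ≡⟨ sum-last (2 * j) h ⟩
  ∑[ i < 2 * j ] h i + χ m m           ≡⟨ cong (∑[ i < 2 * j ] h i +_) (χ-no m m (¬coprime-self 1<m)) ⟩
  ∑[ i < j + (j + 0) ] h i + 0         ≡⟨ +-identityʳ _ ⟩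
  ∑[ i < j + (j + 0) ] h i             ≡⟨ sum-split j (j + 0) h ⟩
  H + ∑[ i < j + 0 ] h (j + i)         ≡⟨ cong (λ k → H + ∑[ i < k ] h (j + i)) (+-identityʳ j) ⟩
  H + ∑[ i < j ] h (j + i)             ≡⟨ cong (H +_) (sum-reverse j (λ i → h (j + i))) ⟩
  H + ∑[ i < j ] h (j + (j ∸ suc i))   ≡⟨ cong (H +_) (sum-cong j mirror) ⟩
  H + H                                ≡⟨ sym (double≡+ H) ⟩
  2 * H                                ∎
  where
  open ≡-Reasoning
  m : ℕ
  m = suc (2 * j)
  h : ℕ → ℕ
  h i = χ m (suc i)
  H : ℕ
  H = ∑[ i < j ] h i
  1<m : 1 < m
  1<m = s≤s (≤-trans 1≤j (m≤m+n j (j + 0)))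
  mirror : ∀ i → i < j → h (j + (j ∸ suc i)) ≡ h i
  mirror i i<j = trans (cong (χ m) (mirror-index i<j))
    (χ-reflect (≤-trans i<j (≤-trans (m≤m+n j (j + 0)) (n≤1+n _))))

φ-odd-even : ∀ j → 1 ≤ j → Even (φ (suc (2 * j)))
φ-odd-even j 1≤j =
  subst Even (sym (φ-odd-halves j 1≤j)) (even-double (∑[ i < j ] χ (suc (2 * j)) (suc i)))

-- (C) φ(n) is even for n ≥ 3; even n = 2k reduce to k via (A) or (B).
φ-even : ∀ n → 3 ≤ n → Even (φ n)
φ-even n 3≤n with parity n | 3≤n
... | odd zero    | s≤s ()
... | odd (suc j) | _ = φ-odd-even (suc j) (s≤s z≤n)
... | even k      | 3≤2k with parity k | 3≤2k
...   | even l      | _ =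
  subst Even (sym (φ-double-even (2 * l) (even-double l))) (even-double (φ (2 * l)))
...   | odd zero    | s≤s (s≤s ())
...   | odd (suc l) | _ =
  subst Even (sym (φ-double-odd k (odd-double+1 (suc l)))) (φ-odd-even (suc l) (s≤s z≤n))

-- Hence φ never takes an odd value s ≥ 3 (φ(1) = φ(2) = 1 and φ(0) = 0).
φ≢odd : ∀ {s} m → Odd s → 3 ≤ s → φ m ≢ s
φ≢odd 0 _ (s≤s _) ()
φ≢odd 1 _ (s≤s (s≤s (s≤s _))) ()
φ≢odd 2 _ (s≤s (s≤s (s≤s _))) ()
φ≢odd m@(suc (suc (suc _))) os _ refl = even⇒¬odd (φ m) (φ-even m (s≤s (s≤s (s≤s z≤n)))) os

-- If φ(2m) = 2s with s odd and ≥ 3, then m is odd: for even m, (A) would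
-- give φ(m) = s.
odd-half-of-even-solution : ∀ {s} m → Odd s → 3 ≤ s → φ (2 * m) ≡ 2 * s → Odd m
odd-half-of-even-solution {s} m os 3≤s e with even-or-odd m
... | inj₂ om = om
... | inj₁ em = ⊥-elim (φ≢odd m os 3≤s (*-cancelˡ-≡ (φ m) s 2 (trans (sym (φ-double-even m em)) e)))

double-positive : ∀ {m} → 0 < m → 0 < 2 * m
double-positive {suc _} _ = s≤s z≤n

half-positive : ∀ {m n} → 2 * m ≡ n → 0 < n → 0 < m
half-positive {zero} refl ()
half-positive {suc _} _ _ = s≤s z≤n

-- Solutions with the same n are equal: the side conditions are proof-irrelevant.
solution-≡ : ∀ {r k n n′} {c : 0 < n × n % 2 ≡ r × φ n ≡ k} {c′ : 0 < n′ × n′ % 2 ≡ r × φ n′ ≡ k} →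
  n ≡ n′ → _≡_ {A = Σ ℕ (λ n → 0 < n × n % 2 ≡ r × φ n ≡ k)} (n , c) (n′ , c′)
solution-≡ {c = p , q , e} {c′ = p′ , q′ , e′} refl =
  cong (_ ,_) (cong₂ _,_ (<-irrelevant p p′) (cong₂ _,_ (≡-irrelevant q q′) (≡-irrelevant e e′)))

mainTheorem10 : (s : ℕ) → Odd s → 3 ≤ s → OddPre (2 * s) ↔ EvenPre (2 * s)
mainTheorem10 s os 3≤s = mk↔ₛ′ double halve double∘halve halve∘double
  where
  double : OddPre (2 * s) → EvenPre (2 * s)
  double (n , n>0 , on , e) = 2 * n , double-positive n>0 , even-double n , trans (φ-double-odd n on) e

  halve : EvenPre (2 * s) → OddPre (2 * s)
  halve (n , n>0 , en , e) = m , half-positive 2m≡n n>0 , om , trans (sym (φ-double-odd m om)) e′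
    where
    m : ℕ
    m = ⌊ n /2⌋
    2m≡n : 2 * m ≡ n
    2m≡n = halve-even n en
    e′ : φ (2 * m) ≡ 2 * s
    e′ = trans (cong φ 2m≡n) e
    om : Odd m
    om = odd-half-of-even-solution m os 3≤s e′

  double∘halve : ∀ y → double (halve y) ≡ y
  double∘halve (n , _ , en , _) = solution-≡ (halve-even n en)

  halve∘double : ∀ x → halve (double x) ≡ x
  halve∘double (n , _) = solution-≡ (halve-double n)
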